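{- Let $Q_1$ be a quiver on vertex set $[N_1]$ and $Q_2$ a quiver on vertex set $[N_1+1,N_1+N_2]$. Fix a vertex $a\in(Q_1)_0$ and pairwise distinct vertices $b_1,\dots,b_k\in(Q_2)_0$. If $\underline{\mu}_1\in\mathrm{green}(Q_1)$ and $\underline{\mu}_2\in\mathrm{green}(Q_2)$, then $\underline{\mu}_2\circ\underline{\mu}_1\in\mathrm{green}\big(Q_1\oplus_{(a,a,\dots,a)}^{(b_1,b_2,\dots,b_k)}Q_2\big)$.
   Context: A quiver is a finite directed graph with no loops and no 2-cycles. Mutation $\mu_k$ at a (non-frozen) vertex $k$: for each 2-path $i\to k\to j$ add an arrow $i\to j$, reverse all arrows incident to $k$, then delete 2-cycles. Mutation sequences are applied right to left (so in $\underline{\mu}_2\circ\underline{\mu}_1$, $\underline{\mu}_1$ is applied first). For a quiver $Q$ on vertices $[N]$, the framed quiver $\widehat{Q}$ is obtained by adjoining frozen vertices $1',\dots,N'$ and arrows $i\to i'$; frozen vertices are never mutated. In a quiver obtained from $\widehat{Q}$ by mutations, a mutable vertex $i$ is green if all arrows between $i$ and frozen vertices point away from $i$, and red if they all point towards $i$. A green sequence is a mutation sequence at mutable vertices in which each mutation is performed at a vertex that is green at that moment; it is maximal if at the end all mutable vertices are red. $\mathrm{green}(Q)$ denotes the set of maximal green sequences of $\widehat{Q}$. Direct sum: given a quiver $Q_1$ on $[N_1]$, a quiver $Q_2$ on $[N_1+1,N_1+N_2]$, an ordered $k$-multiset $(a_1,\dots,a_k)$ of vertices of $Q_1$ and a $k$-multiset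 $(b_1,\dots,b_k)$ of vertices of $Q_2$, the quiver $Q_1\oplus_{(a_1,\dots,a_k)}^{(b_1,\dots,b_k)}Q_2$ has vertex set $[N_1+N_2]$ and arrows those of $Q_1$, those of $Q_2$, and one arrow $a_i\to b_i$ for each $i\in[k]$. Mutation sequences of $Q_1$ and $Q_2$ are regarded as mutation sequences of the direct sum via the inclusion of vertex sets. -}

module Defs where

open import Data.Nat using (ℕ; zero; suc; _+_; _*_; _∸_)
open import Data.Fin using (Fin; zero; suc; _↑ˡ_; _↑ʳ_; splitAt)
open import Data.Fin.Properties using () renaming (_≟_ to _≟ᶠ_)
open import Data.Sum using (_⊎_; inj₁; inj₂)
open import Data.Sum.Properties using (≡-dec)
open import Data.Product using (_×_)
open import Data.Unit using (⊤)
open import Data.List using (List; []; _∷_)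
open import Relation.Nullary using (yes; no)
open import Relation.Binary.Definitions using (DecidableEquality)
open import Relation.Binary.PropositionalEquality using (_≡_)

-- A (multi)quiver on a vertex type V is given by its arrow counts:
-- Arrows V i j = number of arrows i → j.
Arrows : Set → Set
Arrows V = V → V → ℕ

record IsQuiver {n : ℕ} (A : Arrows (Fin n)) : Set where
  field
    noLoop   : ∀ i → A i i ≡ 0
    no2cycle : ∀ i j → (A i j ≡ 0) ⊎ (A j i ≡ 0)

-- Mutation at k: for each 2-path i→k→j add an arrow i→j, reverse arrows at k,
-- then delete 2-cycles (cancel opposite arrows pairwise).
mutate : {V : Set} → DecidableEquality V → V → Arrows V → Arrows V
mutate _≟_ k A i j with i ≟ k | j ≟ k
... | yes _ | _     = A j i
... | no _  | yes _ = A j i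
... | no _  | no _  = (A i j + A i k * A k j) ∸ (A j i + A j k * A k i)

-- Framed vertices: inj₁ i = mutable vertex i, inj₂ i = frozen vertex i'.
FV : ℕ → Set
FV n = Fin n ⊎ Fin n

_≟FV_ : {n : ℕ} → DecidableEquality (FV n)
_≟FV_ = ≡-dec _≟ᶠ_ _≟ᶠ_

framed : {n : ℕ} → Arrows (Fin n) → Arrows (FV n)
framed A (inj₁ i) (inj₁ j) = A i j
framed A (inj₁ i) (inj₂ j) with i ≟ᶠ j
... | yes _ = 1
... | no _  = 0
framed A (inj₂ i) _ = 0

mutateF : {n : ℕ} → Fin n → Arrows (FV n) → Arrows (FV n)
mutateF k A = mutate _≟FV_ (inj₁ k) A

-- A mutation sequence is a list of mutable vertices IN ORDER OF APPLICATION
-- (head is applied first).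
mutateSeq : {n : ℕ} → List (Fin n) → Arrows (FV n) → Arrows (FV n)
mutateSeq []       A = A
mutateSeq (k ∷ ks) A = mutateSeq ks (mutateF k A)

IsGreen : {n : ℕ} → Arrows (FV n) → Fin n → Set
IsGreen {n} A i = (j : Fin n) → A (inj₂ j) (inj₁ i) ≡ 0

IsRed : {n : ℕ} → Arrows (FV n) → Fin n → Set
IsRed {n} A i = (j : Fin n) → A (inj₁ i) (inj₂ j) ≡ 0

GreenSeq : {n : ℕ} → Arrows (FV n) → List (Fin n) → Set
GreenSeq A []       = ⊤
GreenSeq A (k ∷ ks) = IsGreen A k × GreenSeq (mutateF k A) ks

-- μ ∈ green(Q): maximal green sequence of Q̂
InGreen : {n : ℕ} → Arrows (Fin n) → List (Fin n) → Set
InGreen {n} Q μ = GreenSeq (framed Q) μ × ((i : Fin n) → IsRed (mutateSeq μ (framed Q)) i)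

sumFin : {k : ℕ} → (Fin k → ℕ) → ℕ
sumFin {zero}  f = 0
sumFin {suc k} f = f zero + sumFin (λ t → f (suc t))

countPairs : {k N₁ N₂ : ℕ} → (Fin k → Fin N₁) → (Fin k → Fin N₂) → Fin N₁ → Fin N₂ → ℕ
countPairs as bs x y = sumFin (λ t → ind (as t ≟ᶠ x) (bs t ≟ᶠ y))
  where
  ind : ∀ {P R : Set} → Relation.Nullary.Dec P → Relation.Nullary.Dec R → ℕ
  ind (yes _) (yes _) = 1
  ind _ _ = 0

-- Direct sum Q₁ ⊕_{(a_1..a_k)}^{(b_1..b_k)} Q₂ on vertex set [N₁+N₂]:
-- Q₁ on the first N₁ vertices (inject+), Q₂ on the last N₂ (raise N₁),
-- plus one arrow a_t → b_t for each t.
directSum : {N₁ N₂ k : ℕ} → Arrows (Fin N₁) → Arrows (Fin N₂)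
          → (Fin k → Fin N₁) → (Fin k → Fin N₂) → Arrows (Fin (N₁ + N₂))
directSum {N₁} A₁ A₂ as bs i j with splitAt N₁ i | splitAt N₁ j
... | inj₁ x | inj₁ y = A₁ x y
... | inj₂ x | inj₂ y = A₂ x y
... | inj₁ x | inj₂ y = countPairs as bs x y
... | inj₂ x | inj₁ y = 0

incl₁ : {N₁ N₂ : ℕ} → List (Fin N₁) → List (Fin (N₁ + N₂))
incl₁ {N₁} {N₂} = Data.List.map (λ i → i ↑ˡ N₂)

incl₂ : {N₁ N₂ : ℕ} → List (Fin N₂) → List (Fin (N₁ + N₂))
incl₂ {N₁} = Data.List.map (λ i → N₁ ↑ʳ i)

module Submission where

open import Defs
open import Data.Nat using (ℕ; _+_)
open import Data.Fin using (Fin)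
open import Data.List using (List; _++_)
open import Function.Definitions using (Injective)
open import Relation.Binary.PropositionalEquality using (_≡_)

open import Data.Nat using (zero; suc; _*_; _∸_; z≤n)
import Data.Nat.Properties as ℕP
import Data.Nat.Tactic.RingSolver as ℕ-Solver
import Data.Integer.Tactic.RingSolver as ℤ-Solver
open import Data.Integer as ℤ using (ℤ; +_; -_)
  renaming (_+_ to _+ℤ_; _-_ to _-ℤ_; _*_ to _*ℤ_)
import Data.Integer.Properties as ℤP
open import Data.Fin using (zero; suc; _↑ˡ_; _↑ʳ_; splitAt)
import Data.Fin.Properties as FinP
open import Data.Fin.Properties using () renaming (_≟_ to _≟ᶠ_)
open import Data.Sum using (_⊎_; inj₁; inj₂)
import Data.Sum.Properties as SumP
open import Data.Product using (_×_; _,_; proj₁; proj₂; ∃-syntax)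
open import Data.Unit using (tt)
open import Data.Vec.Functional using (head; tail)
open import Algebra.Properties.Semiring.Sum ℤP.+-*-semiring
  using (sum; sum-cong-≗; sum-replicate-zero; ∑-distrib-+; *-distribˡ-sum)
open import Data.Empty using (⊥-elim)
open import Function using (_∘_)
open import Data.List using ([]; _∷_)
open import Relation.Nullary using (Dec; yes; no)
open import Relation.Binary.Definitions using (DecidableEquality)
open import Relation.Binary.PropositionalEquality
  using (_≢_; refl; sym; trans; cong; cong₂; subst; module ≡-Reasoning)

-- We follow μ₁ and then μ₂ on the framed quiver of Q, comparing it throughout
-- with the framed summand that is being mutated.
-- * Left phase (LeftPhase).  Mutations inside Q₁ see a mutable vertex v of Q₂
--   exactly like c_v copies of the frozen vertex a′ (c_v = #arrows a → v); this
--   survives mutation (mutate-scaled), the Q₂-block is untouched (mutate-keeps),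
--   and the Q₁-block evolves like the framed Q₁ (mutate-restrict), so greenness
--   lifts.  At the end Q₁ is red, so all arrows between Q₁ and Q₂ point into Q₁.
-- * Right phase (RightPhase).  During μ₂ each column (b_{v s})_v, s in the
--   framed Q₁, stays a fixed non-negative combination of the c-vectors of Q₂,
--   since both follow the same sign-coherent mutation rule.  Greenness of κ in
--   Q₂ hence gives greenness in Q, and at the end redness of Q₂ makes Q red.

-- Quivers without 2-cycles.
TwoCycleFree : {V : Set} → Arrows V → Set
TwoCycleFree A = ∀ p q → (A p q ≡ 0) ⊎ (A q p ≡ 0)

one-truncated-difference-vanishes : ∀ m n → (m ∸ n ≡ 0) ⊎ (n ∸ m ≡ 0)
one-truncated-difference-vanishes m n with ℕP.≤-total m n
... | inj₁ m≤n = inj₁ (ℕP.m≤n⇒m∸n≡0 m≤n)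
... | inj₂ n≤m = inj₂ (ℕP.m≤n⇒m∸n≡0 n≤m)

NoTwoPath : {V : Set} → Arrows V → V → V → V → Set
NoTwoPath A p k q = (A p k ≡ 0) ⊎ (A k q ≡ 0)

no-two-path-count : {V : Set} (A : Arrows V) {p k q : V} → NoTwoPath A p k q → A p k * A k q ≡ 0
no-two-path-count A {k = k} {q} (inj₁ pk≡0) rewrite pk≡0 = refl
no-two-path-count A {p} {k} (inj₂ kq≡0) rewrite kq≡0 = ℕP.*-zeroʳ (A p k)

module MutationEntries {V : Set} (_≟_ : DecidableEquality V) (k : V) (A : Arrows V) where

  private
    A′ : Arrows V
    A′ = mutate _≟_ k A

  mutate-from-k : ∀ q → A′ k q ≡ A q k
  mutate-from-k q with k ≟ k
  ... | yes _   = refl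
  ... | no k≢k = ⊥-elim (k≢k refl)

  mutate-to-k : ∀ p → p ≢ k → A′ p k ≡ A k p
  mutate-to-k p p≢k with p ≟ k | k ≟ k
  ... | yes p≡k | _       = ⊥-elim (p≢k p≡k)
  ... | no _    | yes _   = refl
  ... | no _    | no k≢k = ⊥-elim (k≢k refl)

  mutate-away : ∀ p q → p ≢ k → q ≢ k →
    A′ p q ≡ (A p q + A p k * A k q) ∸ (A q p + A q k * A k p)
  mutate-away p q p≢k q≢k with p ≟ k | q ≟ k
  ... | yes p≡k | _       = ⊥-elim (p≢k p≡k)
  ... | no _    | yes q≡k = ⊥-elim (q≢k q≡k)
  ... | no _    | no _    = refl

  -- Mutation creates no 2-cycles: the cancellation step leaves a truncated
  -- difference in one of the two directions.
  mutate-twoCycleFree : TwoCycleFree A → TwoCycleFree A′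
  mutate-twoCycleFree tcf p q with p ≟ k | q ≟ k
  ... | yes refl | yes refl = tcf k k
  ... | yes refl | no _     = tcf q k
  ... | no _     | yes refl = tcf k p
  ... | no _     | no _     = one-truncated-difference-vanishes
                                (A p q + A p k * A k q) (A q p + A q k * A k p)

  mutate-keeps-absent : ∀ p q → p ≢ k → q ≢ k →
    A p q ≡ 0 → NoTwoPath A p k q → A′ p q ≡ 0
  mutate-keeps-absent p q p≢k q≢k pq≡0 no-pkq
    rewrite mutate-away p q p≢k q≢k | pq≡0 | no-two-path-count A no-pkq =
    ℕP.0∸n≡0 (A q p + A q k * A k p)

  mutate-keeps : TwoCycleFree A → ∀ p q → p ≢ k → q ≢ k →
    NoTwoPath A p k q → NoTwoPath A q k p → A′ p q ≡ A p q
  mutate-keeps tcf p q p≢k q≢k no-pkq no-qkp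
    rewrite mutate-away p q p≢k q≢k | no-two-path-count A no-pkq | no-two-path-count A no-qkp
          | ℕP.+-identityʳ (A p q) | ℕP.+-identityʳ (A q p)
    with tcf p q
  ... | inj₁ pq≡0 rewrite pq≡0 = ℕP.0∸n≡0 (A q p)
  ... | inj₂ qp≡0 rewrite qp≡0 = refl

open MutationEntries public

mutate-restrict : {V W : Set} (_≟V_ : DecidableEquality V) (_≟W_ : DecidableEquality W)
  (e : V → W) → Injective _≡_ _≡_ e → (k : V) (A : Arrows W) (B : Arrows V) →
  (∀ x y → A (e x) (e y) ≡ B x y) →
  ∀ p q → mutate _≟W_ (e k) A (e p) (e q) ≡ mutate _≟V_ k B p q
mutate-restrict _≟V_ _≟W_ e e-inj k A B A∘e≡B p q with p ≟V k | q ≟V k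
... | yes refl | _ =
  trans (mutate-from-k _≟W_ (e k) A (e q)) (A∘e≡B q k)
... | no p≢k | yes refl =
  trans (mutate-to-k _≟W_ (e k) A (e p) (p≢k ∘ e-inj)) (A∘e≡B k p)
... | no p≢k | no q≢k = begin
  mutate _≟W_ (e k) A (e p) (e q)
    ≡⟨ mutate-away _≟W_ (e k) A (e p) (e q) (p≢k ∘ e-inj) (q≢k ∘ e-inj) ⟩
  (A (e p) (e q) + A (e p) (e k) * A (e k) (e q)) ∸ (A (e q) (e p) + A (e q) (e k) * A (e k) (e p))
    ≡⟨ cong₂ _∸_ (cong₂ _+_ (A∘e≡B p q) (cong₂ _*_ (A∘e≡B p k) (A∘e≡B k q)))
                 (cong₂ _+_ (A∘e≡B q p) (cong₂ _*_ (A∘e≡B q k) (A∘e≡B k p))) ⟩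
  (B p q + B p k * B k q) ∸ (B q p + B q k * B k p) ∎
  where open ≡-Reasoning

ScaledAt : {V : Set} → Arrows V → ℕ → V → V → V → Set
ScaledAt A c x y p = (A p x ≡ c * A p y) × (A x p ≡ c * A y p)

scaled-difference : ∀ c {m m′ n n′} → m ≡ c * m′ → n ≡ c * n′ → m ∸ n ≡ c * (m′ ∸ n′)
scaled-difference c {m′ = m′} {n′ = n′} refl refl = sym (ℕP.*-distribˡ-∸ c m′ n′)

scaled-path-count : ∀ c {d d′ w} u v → d ≡ c * d′ → w ≡ c * v → d + u * w ≡ c * (d′ + u * v)
scaled-path-count c {d′ = d′} u v refl refl = scaled c d′ u v
  where
  scaled : ∀ c d′ u v → c * d′ + u * (c * v) ≡ c * (d′ + u * v)
  scaled = ℕ-Solver.solve-∀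

scaled-path-count′ : ∀ c {d d′ w} u v → d ≡ c * d′ → w ≡ c * u → d + w * v ≡ c * (d′ + u * v)
scaled-path-count′ c {d′ = d′} u v refl refl = scaled c d′ u v
  where
  scaled : ∀ c d′ u v → c * d′ + (c * u) * v ≡ c * (d′ + u * v)
  scaled = ℕ-Solver.solve-∀

-- This is why, while mutating inside
-- Q₁, each vertex v of Q₂ keeps behaving like c_v copies of the frozen a′.
mutate-scaled : {V : Set} (_≟_ : DecidableEquality V) (k : V) (A : Arrows V)
  (c : ℕ) (x y : V) → x ≢ k → y ≢ k → ScaledAt A c x y k →
  ∀ p → ScaledAt A c x y p → ScaledAt (mutate _≟_ k A) c x y p
mutate-scaled _≟_ k A c x y x≢k y≢k (kx , xk) p (px , xp) = by-cases (p ≟ k)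
  where
  by-cases : Dec (p ≡ k) → ScaledAt (mutate _≟_ k A) c x y p
  by-cases (yes refl) =
    trans (mutate-from-k _≟_ k A x) (trans xk (cong (c *_) (sym (mutate-from-k _≟_ k A y)))) ,
    trans (mutate-to-k _≟_ k A x x≢k) (trans kx (cong (c *_) (sym (mutate-to-k _≟_ k A y y≢k))))
  by-cases (no p≢k) =
    trans (mutate-away _≟_ k A p x p≢k x≢k)
      (trans (scaled-difference c (scaled-path-count c (A p k) (A k y) px kx)
                                  (scaled-path-count′ c (A y k) (A k p) xp xk))
             (cong (c *_) (sym (mutate-away _≟_ k A p y p≢k y≢k)))) ,
    trans (mutate-away _≟_ k A x p x≢k p≢k)
      (trans (scaled-difference c (scaled-path-count′ c (A y k) (A k p) xp xk)
                                  (scaled-path-count c (A p k) (A k y) px kx))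
             (cong (c *_) (sym (mutate-away _≟_ k A y p y≢k p≢k))))

exchange : {V : Set} → Arrows V → V → V → ℤ
exchange A p q = + A p q -ℤ + A q p

exchange-one-way : {V : Set} (A : Arrows V) (p q : V) → A q p ≡ 0 → exchange A p q ≡ + A p q
exchange-one-way A p q qp≡0 = trans (cong (λ n → + A p q -ℤ + n) qp≡0) (ℤP.+-identityʳ (+ A p q))

signed-truncated-difference : ∀ m n → + (m ∸ n) -ℤ + (n ∸ m) ≡ + m -ℤ + n
signed-truncated-difference m n
  rewrite ℤP.[+m]-[+n]≡m⊖n (m ∸ n) (n ∸ m) | ℤP.[+m]-[+n]≡m⊖n m n
  with ℕP.≤-total m n
... | inj₁ m≤n rewrite ℕP.m≤n⇒m∸n≡0 m≤n | ℤP.⊖-≤ m≤n = ℤP.⊖-≤ z≤n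
... | inj₂ n≤m rewrite ℕP.m≤n⇒m∸n≡0 n≤m | ℤP.⊖-≥ n≤m = ℤP.⊖-≥ z≤n

module ExchangeMutation {V : Set} (_≟_ : DecidableEquality V) (k : V) (A : Arrows V) where

  private
    A′ : Arrows V
    A′ = mutate _≟_ k A

  exchange-mutate-at-k : ∀ q → q ≢ k → exchange A′ k q ≡ - exchange A k q
  exchange-mutate-at-k q q≢k
    rewrite mutate-from-k _≟_ k A q | mutate-to-k _≟_ k A q q≢k
          | ℤP.[+m]-[+n]≡m⊖n (A q k) (A k q) | ℤP.[+m]-[+n]≡m⊖n (A k q) (A q k) =
    ℤP.⊖-swap (A q k) (A k q)

  exchange-mutate-coherent : ∀ p q → p ≢ k → q ≢ k → NoTwoPath A q k p →
    exchange A′ p q ≡ exchange A p q +ℤ + A p k *ℤ + A k q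
  exchange-mutate-coherent p q p≢k q≢k no-qkp = begin
    exchange A′ p q
      ≡⟨ cong₂ (λ m n → + m -ℤ + n) (mutate-away _≟_ k A p q p≢k q≢k) (mutate-away _≟_ k A q p q≢k p≢k) ⟩
    + ((A p q + A p k * A k q) ∸ (A q p + A q k * A k p)) -ℤ + ((A q p + A q k * A k p) ∸ (A p q + A p k * A k q))
      ≡⟨ signed-truncated-difference (A p q + A p k * A k q) (A q p + A q k * A k p) ⟩
    + (A p q + A p k * A k q) -ℤ + (A q p + A q k * A k p)
      ≡⟨ cong₂ _-ℤ_ (trans (ℤP.pos-+ (A p q) _) (cong (_+ℤ_ (+ A p q)) (ℤP.pos-* (A p k) (A k q))))
                    (cong +_ (trans (cong (_+_ (A q p)) (no-two-path-count A no-qkp)) (ℕP.+-identityʳ (A q p)))) ⟩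
    (+ A p q +ℤ + A p k *ℤ + A k q) -ℤ + A q p
      ≡⟨ rearrange (+ A p q) (+ A p k *ℤ + A k q) (+ A q p) ⟩
    exchange A p q +ℤ + A p k *ℤ + A k q ∎
    where
    open ≡-Reasoning
    rearrange : ∀ x y z → (x +ℤ y) -ℤ z ≡ (x -ℤ z) +ℤ y
    rearrange = ℤ-Solver.solve-∀

open ExchangeMutation public

exchange-antisymmetric : {V : Set} (A : Arrows V) (p q : V) → exchange A q p ≡ - exchange A p q
exchange-antisymmetric A p q = antisymmetric (+ A p q) (+ A q p)
  where
  antisymmetric : ∀ x y → y -ℤ x ≡ - (x -ℤ y)
  antisymmetric = ℤ-Solver.solve-∀

nonneg-exchange-absent : {V : Set} {A : Arrows V} → TwoCycleFree A →
  ∀ p q {n} → exchange A p q ≡ + n → A q p ≡ 0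
nonneg-exchange-absent {A = A} tcf p q {n} bpq≡n with tcf p q
... | inj₂ qp≡0 = qp≡0
... | inj₁ pq≡0 rewrite pq≡0 = negation-nonneg (A q p) (trans (sym (ℤP.+-identityˡ _)) bpq≡n)
  where
  negation-nonneg : ∀ x → - (+ x) ≡ + n → x ≡ 0
  negation-nonneg zero    _ = refl
  negation-nonneg (suc x) ()

combination : {n : ℕ} → (Fin n → ℕ) → (Fin n → ℤ) → ℤ
combination m f = sum (λ y → + m y *ℤ f y)

combination-cong : {n : ℕ} (m : Fin n → ℕ) {f g : Fin n → ℤ} →
  (∀ y → f y ≡ g y) → combination m f ≡ combination m g
combination-cong m f≗g = sum-cong-≗ (λ y → cong (_*ℤ_ (+ m y)) (f≗g y))

combination-linear : {n : ℕ} (m : Fin n → ℕ) (f g : Fin n → ℤ) (c : ℤ) →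
  combination m (λ y → f y +ℤ c *ℤ g y) ≡ combination m f +ℤ c *ℤ combination m g
combination-linear m f g c = begin
  sum (λ y → + m y *ℤ (f y +ℤ c *ℤ g y))
    ≡⟨ sum-cong-≗ (λ y → distribute (+ m y) (f y) (g y) c) ⟩
  sum (λ y → + m y *ℤ f y +ℤ c *ℤ (+ m y *ℤ g y))
    ≡⟨ ∑-distrib-+ (λ y → + m y *ℤ f y) (λ y → c *ℤ (+ m y *ℤ g y)) ⟩
  combination m f +ℤ sum (λ y → c *ℤ (+ m y *ℤ g y))
    ≡⟨ cong (combination m f +ℤ_) (sym (*-distribˡ-sum c (λ y → + m y *ℤ g y))) ⟩
  combination m f +ℤ c *ℤ combination m g ∎
  where
  open ≡-Reasoning
  distribute : ∀ w x y c → w *ℤ (x +ℤ c *ℤ y) ≡ w *ℤ x +ℤ c *ℤ (w *ℤ y)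
  distribute = ℤ-Solver.solve-∀

combination-neg : {n : ℕ} (m : Fin n → ℕ) (f : Fin n → ℤ) →
  combination m (λ y → - f y) ≡ - combination m f
combination-neg m f = begin
  sum (λ y → + m y *ℤ - f y)          ≡⟨ sum-cong-≗ (λ y → negate (+ m y) (f y)) ⟩
  sum (λ y → ℤ.-1ℤ *ℤ (+ m y *ℤ f y)) ≡⟨ sym (*-distribˡ-sum ℤ.-1ℤ (λ y → + m y *ℤ f y)) ⟩
  ℤ.-1ℤ *ℤ combination m f            ≡⟨ ℤP.-1*i≡-i (combination m f) ⟩
  - combination m f                   ∎
  where
  open ≡-Reasoning
  negate : ∀ w x → w *ℤ - x ≡ ℤ.-1ℤ *ℤ (w *ℤ x)
  negate = ℤ-Solver.solve-∀

combination-nonneg : {n : ℕ} (m g : Fin n → ℕ) → ∃[ s ] combination m (λ y → + g y) ≡ + s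
combination-nonneg {zero} m g = 0 , refl
combination-nonneg {suc n} m g with combination-nonneg (tail m) (tail g)
... | s , rest≡s =
  head m * head g + s ,
  trans (cong₂ _+ℤ_ (sym (ℤP.pos-* (head m) (head g))) rest≡s) (sym (ℤP.pos-+ (head m * head g) s))

combination-indicator : {n : ℕ} (m : Fin n → ℕ) (f : Fin n → ℤ) (v : Fin n) →
  f v ≡ + 1 → (∀ y → y ≢ v → f y ≡ + 0) → combination m f ≡ + m v
combination-indicator {suc n} m f zero f0≡1 f≡0 = begin
  + head m *ℤ f zero +ℤ combination (tail m) (tail f)
    ≡⟨ cong₂ _+ℤ_ (cong (_*ℤ_ (+ head m)) f0≡1) (vanishing (λ y → f≡0 (suc y) (λ ()))) ⟩
  + head m *ℤ + 1 +ℤ + 0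
    ≡⟨ trans (ℤP.+-identityʳ _) (ℤP.*-identityʳ (+ head m)) ⟩
  + head m ∎
  where
  open ≡-Reasoning
  vanishing : (∀ y → tail f y ≡ + 0) → combination (tail m) (tail f) ≡ + 0
  vanishing tail-f≡0 =
    trans (sum-cong-≗ (λ y → trans (cong (_*ℤ_ (+ tail m y)) (tail-f≡0 y)) (ℤP.*-zeroʳ (+ tail m y))))
          (sum-replicate-zero n)
combination-indicator {suc n} m f (suc v) fv≡1 f≡0 = begin
  + head m *ℤ f zero +ℤ combination (tail m) (tail f)
    ≡⟨ cong (_+ℤ combination (tail m) (tail f))
            (trans (cong (_*ℤ_ (+ head m)) (f≡0 zero (λ ()))) (ℤP.*-zeroʳ (+ head m))) ⟩
  + 0 +ℤ combination (tail m) (tail f)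
    ≡⟨ ℤP.+-identityˡ _ ⟩
  combination (tail m) (tail f)
    ≡⟨ combination-indicator (tail m) (tail f) v fv≡1 (λ y y≢v → f≡0 (suc y) (y≢v ∘ FinP.suc-injective)) ⟩
  + m (suc v) ∎
  where open ≡-Reasoning

framed-own-frozen : {n : ℕ} (A : Arrows (Fin n)) (i : Fin n) → framed A (inj₁ i) (inj₂ i) ≡ 1
framed-own-frozen A i with i ≟ᶠ i
... | yes _   = refl
... | no i≢i = ⊥-elim (i≢i refl)

framed-other-frozen : {n : ℕ} (A : Arrows (Fin n)) (i j : Fin n) → i ≢ j →
  framed A (inj₁ i) (inj₂ j) ≡ 0
framed-other-frozen A i j i≢j with i ≟ᶠ j
... | yes i≡j = ⊥-elim (i≢j i≡j)
... | no _    = refl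

mutateSeq-++ : {n : ℕ} (xs ys : List (Fin n)) (A : Arrows (FV n)) →
  mutateSeq (xs ++ ys) A ≡ mutateSeq ys (mutateSeq xs A)
mutateSeq-++ []       ys A = refl
mutateSeq-++ (x ∷ xs) ys A = mutateSeq-++ xs ys (mutateF x A)

greenSeq-++ : {n : ℕ} (xs ys : List (Fin n)) (A : Arrows (FV n)) →
  GreenSeq A xs → GreenSeq (mutateSeq xs A) ys → GreenSeq A (xs ++ ys)
greenSeq-++ []       ys A _            green-ys = green-ys
greenSeq-++ (x ∷ xs) ys A (gx , green-xs) green-ys = gx , greenSeq-++ xs ys (mutateF x A) green-xs green-ys

module DirectSumVertices (N₁ N₂ : ℕ) where

  L : Fin N₁ → Fin (N₁ + N₂)
  L i = i ↑ˡ N₂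

  R : Fin N₂ → Fin (N₁ + N₂)
  R j = N₁ ↑ʳ j

  ι₁ : FV N₁ → FV (N₁ + N₂)
  ι₁ (inj₁ i) = inj₁ (L i)
  ι₁ (inj₂ i) = inj₂ (L i)

  ι₂ : FV N₂ → FV (N₁ + N₂)
  ι₂ (inj₁ j) = inj₁ (R j)
  ι₂ (inj₂ j) = inj₂ (R j)

  L-injective : Injective _≡_ _≡_ L
  L-injective = FinP.↑ˡ-injective N₂ _ _

  R-injective : Injective _≡_ _≡_ R
  R-injective = FinP.↑ʳ-injective N₁ _ _

  L≢R : ∀ i j → L i ≢ R j
  L≢R i j Li≡Rj with trans (sym (FinP.splitAt-↑ˡ N₁ i N₂))
                           (trans (cong (splitAt N₁) Li≡Rj) (FinP.splitAt-↑ʳ N₁ N₂ j))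
  ... | ()

  ι₁-injective : Injective _≡_ _≡_ ι₁
  ι₁-injective {inj₁ x} {inj₁ y} eq = cong inj₁ (L-injective (SumP.inj₁-injective eq))
  ι₁-injective {inj₂ x} {inj₂ y} eq = cong inj₂ (L-injective (SumP.inj₂-injective eq))

  ι₂-injective : Injective _≡_ _≡_ ι₂
  ι₂-injective {inj₁ x} {inj₁ y} eq = cong inj₁ (R-injective (SumP.inj₁-injective eq))
  ι₂-injective {inj₂ x} {inj₂ y} eq = cong inj₂ (R-injective (SumP.inj₂-injective eq))

  ι₁≢R : ∀ p j → ι₁ p ≢ inj₁ (R j)
  ι₁≢R (inj₁ i) j eq = L≢R i j (SumP.inj₁-injective eq)

  ι₂≢L : ∀ p i → ι₂ p ≢ inj₁ (L i)
  ι₂≢L (inj₁ j) i eq = L≢R i j (sym (SumP.inj₁-injective eq))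

  data Side : Fin (N₁ + N₂) → Set where
    left  : ∀ i → Side (L i)
    right : ∀ j → Side (R j)

  side : ∀ z → Side z
  side z with splitAt N₁ z | FinP.join-splitAt N₁ N₂ z
  ... | inj₁ i | refl = left i
  ... | inj₂ j | refl = right j

module DirectSumArrows {N₁ N₂ k : ℕ} (Q₁ : Arrows (Fin N₁)) (Q₂ : Arrows (Fin N₂))
                       (as : Fin k → Fin N₁) (bs : Fin k → Fin N₂) where

  open DirectSumVertices N₁ N₂

  D : Arrows (Fin (N₁ + N₂))
  D = directSum Q₁ Q₂ as bs

  D-left : ∀ i j → D (L i) (L j) ≡ Q₁ i j
  D-left i j rewrite FinP.splitAt-↑ˡ N₁ i N₂ | FinP.splitAt-↑ˡ N₁ j N₂ = refl

  D-right : ∀ i j → D (R i) (R j) ≡ Q₂ i j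
  D-right i j rewrite FinP.splitAt-↑ʳ N₁ N₂ i | FinP.splitAt-↑ʳ N₁ N₂ j = refl

  D-left-right : ∀ i j → D (L i) (R j) ≡ countPairs as bs i j
  D-left-right i j rewrite FinP.splitAt-↑ˡ N₁ i N₂ | FinP.splitAt-↑ʳ N₁ N₂ j = refl

  D-right-left : ∀ j i → D (R j) (L i) ≡ 0
  D-right-left j i rewrite FinP.splitAt-↑ˡ N₁ i N₂ | FinP.splitAt-↑ʳ N₁ N₂ j = refl

  framed-D-left : ∀ p q → framed D (ι₁ p) (ι₁ q) ≡ framed Q₁ p q
  framed-D-left (inj₁ i) (inj₁ j) = D-left i j
  framed-D-left (inj₁ i) (inj₂ j) with i ≟ᶠ j
  ... | yes refl = framed-own-frozen D (L i)
  ... | no i≢j   = framed-other-frozen D (L i) (L j) (i≢j ∘ L-injective)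
  framed-D-left (inj₂ i) q = refl

  framed-D-right : ∀ p q → framed D (ι₂ p) (ι₂ q) ≡ framed Q₂ p q
  framed-D-right (inj₁ i) (inj₁ j) = D-right i j
  framed-D-right (inj₁ i) (inj₂ j) with i ≟ᶠ j
  ... | yes refl = framed-own-frozen D (R i)
  ... | no i≢j   = framed-other-frozen D (R i) (R j) (i≢j ∘ R-injective)
  framed-D-right (inj₂ i) q = refl

  framed-D-twoCycleFree : IsQuiver Q₁ → IsQuiver Q₂ → TwoCycleFree (framed D)
  framed-D-twoCycleFree Q₁-quiver Q₂-quiver (inj₂ x) q        = inj₁ refl
  framed-D-twoCycleFree Q₁-quiver Q₂-quiver (inj₁ x) (inj₂ y) = inj₂ refl
  framed-D-twoCycleFree Q₁-quiver Q₂-quiver (inj₁ x) (inj₁ y) with side x | side y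
  ... | left i  | left j  rewrite D-left i j | D-left j i = IsQuiver.no2cycle Q₁-quiver i j
  ... | right i | right j rewrite D-right i j | D-right j i = IsQuiver.no2cycle Q₂-quiver i j
  ... | left i  | right j = inj₂ (D-right-left j i)
  ... | right i | left j  = inj₁ (D-right-left i j)

module GreenSequencesOnDirectSum {N₁ N₂ k : ℕ} (Q₁ : Arrows (Fin N₁)) (Q₂ : Arrows (Fin N₂))
                                 (a : Fin N₁) (b : Fin k → Fin N₂) where

  open DirectSumVertices N₁ N₂
  open DirectSumArrows Q₁ Q₂ (λ _ → a) b

  N : ℕ
  N = N₁ + N₂

  a′ : FV N
  a′ = inj₂ (L a)

  c : Fin N₂ → ℕ
  c v = countPairs (λ _ → a) b a v

  -- Invariant while mutating along μ₁: A restricts to A₁ on the left summand and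
  -- to the untouched framed Q₂ on the right; each mutable right vertex v is
  -- joined to the mutable left part like c_v copies of a′; and there are no
  -- arrows between mutable vertices of one side and frozen vertices of the other
  -- (in field names, X′ means the frozen copy of a vertex of X).
  record LeftPhase (A : Arrows (FV N)) (A₁ : Arrows (FV N₁)) : Set where
    field
      left-part     : ∀ p q → A (ι₁ p) (ι₁ q) ≡ A₁ p q
      right-part    : ∀ p q → A (ι₂ p) (ι₂ q) ≡ framed Q₂ p q
      right-like-a′ : ∀ v i → ScaledAt A (c v) (inj₁ (R v)) a′ (inj₁ (L i))
      R′L-absent    : ∀ y i → A (inj₂ (R y)) (inj₁ (L i)) ≡ 0
      LR′-absent    : ∀ y i → A (inj₁ (L i)) (inj₂ (R y)) ≡ 0
      L′R-absent    : ∀ x v → A (inj₂ (L x)) (inj₁ (R v)) ≡ 0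
      two-cycle-free : TwoCycleFree A

  countPairs-elsewhere : ∀ i v → a ≢ i → countPairs (λ _ → a) b i v ≡ 0
  countPairs-elsewhere i v a≢i with a ≟ᶠ i
  ... | yes a≡i = ⊥-elim (a≢i a≡i)
  ... | no _    = vanishing {k}
    where
    vanishing : ∀ {n} → sumFin {n} (λ _ → 0) ≡ 0
    vanishing {zero}  = refl
    vanishing {suc n} = vanishing {n}

  leftPhase-start : IsQuiver Q₁ → IsQuiver Q₂ → LeftPhase (framed D) (framed Q₁)
  leftPhase-start Q₁-quiver Q₂-quiver = record
    { left-part      = framed-D-left
    ; right-part     = framed-D-right
    ; right-like-a′  = λ v i → left-to-right i v , trans (D-right-left v i) (sym (ℕP.*-zeroʳ (c v)))
    ; R′L-absent     = λ y i → refl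
    ; LR′-absent     = λ y i → framed-other-frozen D (L i) (R y) (L≢R i y)
    ; L′R-absent     = λ x v → refl
    ; two-cycle-free = framed-D-twoCycleFree Q₁-quiver Q₂-quiver
    }
    where
    left-to-right : ∀ i v → framed D (inj₁ (L i)) (inj₁ (R v)) ≡ c v * framed D (inj₁ (L i)) a′
    left-to-right i v with a ≟ᶠ i
    ... | yes refl rewrite framed-own-frozen D (L a) | ℕP.*-identityʳ (c v) = D-left-right a v
    ... | no a≢i rewrite framed-other-frozen D (L i) (L a) (λ Li≡La → a≢i (sym (L-injective Li≡La)))
                       | ℕP.*-zeroʳ (c v) = trans (D-left-right i v) (countPairs-elsewhere i v a≢i)

  module LeftStep {A : Arrows (FV N)} {A₁ : Arrows (FV N₁)} (I : LeftPhase A A₁)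
                  (κ : Fin N₁) (κ-green : IsGreen A₁ κ) where

    open LeftPhase I

    K : FV N
    K = inj₁ (L κ)

    R≢K : ∀ v → inj₁ (R v) ≢ K
    R≢K v eq = L≢R κ v (sym (SumP.inj₁-injective eq))

    frozen≢K : ∀ z → inj₂ z ≢ K
    frozen≢K z ()

    L≢K : ∀ {i} → i ≢ κ → inj₁ (L i) ≢ K
    L≢K i≢κ eq = i≢κ (L-injective (SumP.inj₁-injective eq))

    L′K-absent : ∀ x → A (inj₂ (L x)) K ≡ 0
    L′K-absent x = trans (left-part (inj₂ x) (inj₁ κ)) (κ-green x)

    green : IsGreen A (L κ)
    green z with side z
    ... | left x  = L′K-absent x
    ... | right y = R′L-absent y κ

    -- The right summand meets K only through right-like-a′, and a′, K
    -- form no 2-cycle, so no 2-path inside the right summand passes K.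
    no-right-two-path : ∀ p q → NoTwoPath A (ι₂ p) K (ι₂ q)
    no-right-two-path (inj₂ y) q        = inj₁ (R′L-absent y κ)
    no-right-two-path (inj₁ u) (inj₂ y) = inj₂ (LR′-absent y κ)
    no-right-two-path (inj₁ u) (inj₁ v) with two-cycle-free a′ K
    ... | inj₁ a′K≡0 = inj₁ (trans (proj₂ (right-like-a′ u κ)) (trans (cong (c u *_) a′K≡0) (ℕP.*-zeroʳ (c u))))
    ... | inj₂ Ka′≡0 = inj₂ (trans (proj₁ (right-like-a′ v κ)) (trans (cong (c v *_) Ka′≡0) (ℕP.*-zeroʳ (c v))))

    private
      A′ : Arrows (FV N)
      A′ = mutateF (L κ) A

    -- Frozen vertices of Q₂ stay detached from the mutable left part: at K the
    -- arrows are only reversed, elsewhere no 2-path runs through K.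
    R′L-absent′ : ∀ y i → A′ (inj₂ (R y)) (inj₁ (L i)) ≡ 0
    R′L-absent′ y i with i ≟ᶠ κ
    ... | yes refl = trans (mutate-to-k _≟FV_ K A (inj₂ (R y)) (frozen≢K _)) (LR′-absent y κ)
    ... | no i≢κ   = mutate-keeps-absent _≟FV_ K A (inj₂ (R y)) (inj₁ (L i)) (frozen≢K _) (L≢K i≢κ)
                       (R′L-absent y i) (inj₁ (R′L-absent y κ))

    LR′-absent′ : ∀ y i → A′ (inj₁ (L i)) (inj₂ (R y)) ≡ 0
    LR′-absent′ y i with i ≟ᶠ κ
    ... | yes refl = trans (mutate-from-k _≟FV_ K A (inj₂ (R y))) (R′L-absent y κ)
    ... | no i≢κ   = mutate-keeps-absent _≟FV_ K A (inj₁ (L i)) (inj₂ (R y)) (L≢K i≢κ) (frozen≢K _)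
                       (LR′-absent y i) (inj₂ (LR′-absent y κ))

    next : LeftPhase A′ (mutateF κ A₁)
    next = record
      { left-part      = λ p q → mutate-restrict _≟FV_ _≟FV_ ι₁ ι₁-injective (inj₁ κ) A A₁ left-part p q
      ; right-part     = λ p q → trans (mutate-keeps _≟FV_ K A two-cycle-free (ι₂ p) (ι₂ q) (ι₂≢L p κ) (ι₂≢L q κ)
                                          (no-right-two-path p q) (no-right-two-path q p))
                                        (right-part p q)
      ; right-like-a′  = λ v i → mutate-scaled _≟FV_ K A (c v) (inj₁ (R v)) a′ (R≢K v) (frozen≢K _)
                                   (right-like-a′ v κ) (inj₁ (L i)) (right-like-a′ v i)
      ; R′L-absent     = R′L-absent′
      ; LR′-absent     = LR′-absent′
      ; L′R-absent     = λ x v → mutate-keeps-absent _≟FV_ K A (inj₂ (L x)) (inj₁ (R v)) (frozen≢K _) (R≢K v)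
                                   (L′R-absent x v) (inj₁ (L′K-absent x))
      ; two-cycle-free = mutate-twoCycleFree _≟FV_ K A two-cycle-free
      }

  left-phase : ∀ μ {A A₁} → LeftPhase A A₁ → GreenSeq A₁ μ →
    GreenSeq A (incl₁ {N₁} {N₂} μ) × LeftPhase (mutateSeq (incl₁ {N₁} {N₂} μ) A) (mutateSeq μ A₁)
  left-phase []      I _                   = tt , I
  left-phase (κ ∷ μ) I (κ-green , μ-green) with left-phase μ (LeftStep.next I κ κ-green) μ-green
  ... | μ-green′ , I′ = (LeftStep.green I κ κ-green , μ-green′) , I′

  cVector : Arrows (FV N₂) → Fin N₂ → Fin N₂ → ℤ
  cVector A₂ v y = exchange A₂ (inj₁ v) (inj₂ y)

  -- Invariant while mutating along μ₂, with fixed weights m: A restricts to A₂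
  -- on the right summand; each column b_{v s} (v right, s in the framed left
  -- summand) is the m_s-combination of the c-vector of v; the mutable left
  -- vertices stay red.
  record RightPhase (m : FV N₁ → Fin N₂ → ℕ) (A : Arrows (FV N)) (A₂ : Arrows (FV N₂)) : Set where
    field
      right-part     : ∀ p q → A (ι₂ p) (ι₂ q) ≡ A₂ p q
      right-to-left  : ∀ s v → exchange A (inj₁ (R v)) (ι₁ s) ≡ combination (m s) (cVector A₂ v)
      left-red       : ∀ i → IsRed A (L i)
      two-cycle-free : TwoCycleFree A

  rightPhase-start : ∀ {A A₁} → LeftPhase A A₁ → (∀ i → IsRed A₁ i) →
    RightPhase (λ s v → A (inj₁ (R v)) (ι₁ s)) A (framed Q₂)
  rightPhase-start {A} I A₁-red = record
    { right-part     = right-part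
    ; right-to-left  = λ s v → trans (exchange-one-way A (inj₁ (R v)) (ι₁ s) (left-to-right-absent s v))
                                 (sym (combination-indicator (λ y → A (inj₁ (R y)) (ι₁ s)) (cVector (framed Q₂) v) v
                                        (initial-cVector-own v) (initial-cVector-other v)))
    ; left-red       = left-red
    ; two-cycle-free = two-cycle-free
    }
    where
    open LeftPhase I
    initial-cVector-own : ∀ v → cVector (framed Q₂) v v ≡ + 1
    initial-cVector-own v = trans (exchange-one-way (framed Q₂) (inj₁ v) (inj₂ v) refl)
                                  (cong +_ (framed-own-frozen Q₂ v))
    initial-cVector-other : ∀ v y → y ≢ v → cVector (framed Q₂) v y ≡ + 0
    initial-cVector-other v y y≢v = trans (exchange-one-way (framed Q₂) (inj₁ v) (inj₂ y) refl)
                                          (cong +_ (framed-other-frozen Q₂ v y (y≢v ∘ sym)))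
    -- Arrows from Q₁ into R v are c_v copies of arrows into a′, absent as Q₁ is red.
    left-to-right-absent : ∀ s v → A (ι₁ s) (inj₁ (R v)) ≡ 0
    left-to-right-absent (inj₁ i) v =
      trans (proj₁ (right-like-a′ v i))
            (trans (cong (c v *_) (trans (left-part (inj₁ i) (inj₂ a)) (A₁-red i a))) (ℕP.*-zeroʳ (c v)))
    left-to-right-absent (inj₂ x) v = L′R-absent x v
    left-red : ∀ i → IsRed A (L i)
    left-red i z with side z
    ... | left x  = trans (left-part (inj₁ i) (inj₂ x)) (A₁-red i x)
    ... | right y = LR′-absent y i

  module RightStep {m : FV N₁ → Fin N₂ → ℕ} {A : Arrows (FV N)} {A₂ : Arrows (FV N₂)}
                   (I : RightPhase m A A₂) (κ : Fin N₂) (κ-green : IsGreen A₂ κ) where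

    open RightPhase I

    K : FV N
    K = inj₁ (R κ)

    private
      A′ : Arrows (FV N)
      A′ = mutateF (R κ) A
      A₂′ : Arrows (FV N₂)
      A₂′ = mutateF κ A₂

    -- κ is green, so its c-vector is non-negative ...
    cVector-green : ∀ y → cVector A₂ κ y ≡ + A₂ (inj₁ κ) (inj₂ y)
    cVector-green y = exchange-one-way A₂ (inj₁ κ) (inj₂ y) (κ-green y)

    -- ... hence so are the entries b_{K s}: no arrow enters K from the framed Q₁.
    left-K-absent : ∀ s → A (ι₁ s) K ≡ 0
    left-K-absent s with combination-nonneg (m s) (λ y → A₂ (inj₁ κ) (inj₂ y))
    ... | n , combination≡n = nonneg-exchange-absent two-cycle-free K (ι₁ s)
            (trans (right-to-left s κ) (trans (combination-cong (m s) cVector-green) combination≡n))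

    K-to-left : ∀ s → exchange A K (ι₁ s) ≡ + A K (ι₁ s)
    K-to-left s = exchange-one-way A K (ι₁ s) (left-K-absent s)

    green : IsGreen A (R κ)
    green z with side z
    ... | left x  = left-K-absent (inj₂ x)
    ... | right y = trans (right-part (inj₂ y) (inj₁ κ)) (κ-green y)

    -- Mutation at κ negates both b_{κ s} and the c-vector of κ ...
    right-to-left-at-κ : ∀ s → exchange A′ K (ι₁ s) ≡ combination (m s) (cVector A₂′ κ)
    right-to-left-at-κ s = begin
      exchange A′ K (ι₁ s)                               ≡⟨ exchange-mutate-at-k _≟FV_ K A (ι₁ s) (ι₁≢R s κ) ⟩
      - exchange A K (ι₁ s)                              ≡⟨ cong -_ (right-to-left s κ) ⟩
      - combination (m s) (cVector A₂ κ)                 ≡⟨ sym (combination-neg (m s) (cVector A₂ κ)) ⟩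
      combination (m s) (λ y → - cVector A₂ κ y)         ≡⟨ combination-cong (m s) (λ y →
                                                              sym (exchange-mutate-at-k _≟FV_ (inj₁ κ) A₂ (inj₂ y) λ ())) ⟩
      combination (m s) (cVector A₂′ κ)                  ∎
      where open ≡-Reasoning
    -- ... and, for v ≠ κ, transforms both b_{v s} and the c-vector of v by
    -- the same rule x ↦ x + b_{vκ} x_κ (sign-coherence comes from greenness).
    right-to-left-away : ∀ s v → v ≢ κ →
      exchange A′ (inj₁ (R v)) (ι₁ s) ≡ combination (m s) (cVector A₂′ v)
    right-to-left-away s v v≢κ = begin
      exchange A′ V (ι₁ s)
        ≡⟨ exchange-mutate-coherent _≟FV_ K A V (ι₁ s) V≢K (ι₁≢R s κ) (inj₁ (left-K-absent s)) ⟩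
      exchange A V (ι₁ s) +ℤ + A V K *ℤ + A K (ι₁ s)
        ≡⟨ cong₂ (λ x y → x +ℤ + A V K *ℤ y) (right-to-left s v) (sym (K-to-left s)) ⟩
      combination (m s) (cVector A₂ v) +ℤ + A V K *ℤ exchange A K (ι₁ s)
        ≡⟨ cong₂ (λ x y → combination (m s) (cVector A₂ v) +ℤ + x *ℤ y)
                 (right-part (inj₁ v) (inj₁ κ)) (right-to-left s κ) ⟩
      combination (m s) (cVector A₂ v) +ℤ + A₂ (inj₁ v) (inj₁ κ) *ℤ combination (m s) (cVector A₂ κ)
        ≡⟨ sym (combination-linear (m s) (cVector A₂ v) (cVector A₂ κ) (+ A₂ (inj₁ v) (inj₁ κ))) ⟩
      combination (m s) (λ y → cVector A₂ v y +ℤ + A₂ (inj₁ v) (inj₁ κ) *ℤ cVector A₂ κ y)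
        ≡⟨ combination-cong (m s) (λ y → sym (cVector-mutates y)) ⟩
      combination (m s) (cVector A₂′ v) ∎
      where
      open ≡-Reasoning
      V : FV N
      V = inj₁ (R v)
      V≢K : V ≢ K
      V≢K eq = v≢κ (R-injective (SumP.inj₁-injective eq))
      cVector-mutates : ∀ y → cVector A₂′ v y ≡ cVector A₂ v y +ℤ + A₂ (inj₁ v) (inj₁ κ) *ℤ cVector A₂ κ y
      cVector-mutates y =
        trans (exchange-mutate-coherent _≟FV_ (inj₁ κ) A₂ (inj₁ v) (inj₂ y) (v≢κ ∘ SumP.inj₁-injective) (λ ())
                 (inj₁ (κ-green y)))
              (cong (λ x → cVector A₂ v y +ℤ + A₂ (inj₁ v) (inj₁ κ) *ℤ x) (sym (cVector-green y)))

    right-to-left′ : ∀ s v → exchange A′ (inj₁ (R v)) (ι₁ s) ≡ combination (m s) (cVector A₂′ v)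
    right-to-left′ s v = by-cases (v ≟ᶠ κ)
      where
      by-cases : Dec (v ≡ κ) → exchange A′ (inj₁ (R v)) (ι₁ s) ≡ combination (m s) (cVector A₂′ v)
      by-cases (yes refl) = right-to-left-at-κ s
      by-cases (no v≢κ)   = right-to-left-away s v v≢κ

    next : RightPhase m A′ A₂′
    next = record
      { right-part     = mutate-restrict _≟FV_ _≟FV_ ι₂ ι₂-injective (inj₁ κ) A A₂ right-part
      ; right-to-left  = right-to-left′
      ; left-red       = λ i z → mutate-keeps-absent _≟FV_ K A (inj₁ (L i)) (inj₂ z) (ι₁≢R (inj₁ i) κ) (λ ())
                                   (left-red i z) (inj₁ (left-K-absent (inj₁ i)))
      ; two-cycle-free = mutate-twoCycleFree _≟FV_ K A two-cycle-free
      }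

  right-phase : ∀ {m} μ {A A₂} → RightPhase m A A₂ → GreenSeq A₂ μ →
    GreenSeq A (incl₂ {N₁} {N₂} μ) × RightPhase m (mutateSeq (incl₂ {N₁} {N₂} μ) A) (mutateSeq μ A₂)
  right-phase []      I _                   = tt , I
  right-phase (κ ∷ μ) I (κ-green , μ-green) with right-phase μ (RightStep.next I κ κ-green) μ-green
  ... | μ-green′ , I′ = (RightStep.green I κ κ-green , μ-green′) , I′

  -- When Q₂ has turned red, the c-vectors of Q₂ are non-positive, hence so are
  -- the columns b_{v x′}; together with the red left part, everything is red.
  all-red : ∀ {m A A₂} → RightPhase m A A₂ → (∀ v → IsRed A₂ v) → ∀ z → IsRed A z
  all-red {m} {A} {A₂} I A₂-red z with side z
  ... | left i  = left-red i
    where open RightPhase I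
  ... | right v = right-red
    where
    open RightPhase I
    cVector-red : ∀ y → cVector A₂ v y ≡ - (+ A₂ (inj₂ y) (inj₁ v))
    cVector-red y = trans (cong (λ n → + n -ℤ + A₂ (inj₂ y) (inj₁ v)) (A₂-red v y)) (ℤP.+-identityˡ _)
    right-red : IsRed A (R v)
    right-red z′ with side z′
    ... | right y = trans (right-part (inj₁ v) (inj₂ y)) (A₂-red v y)
    ... | left x with combination-nonneg (m (inj₂ x)) (λ y → A₂ (inj₂ y) (inj₁ v))
    ...   | n , combination≡n = nonneg-exchange-absent two-cycle-free (inj₂ (L x)) (inj₁ (R v)) (begin
      exchange A (inj₂ (L x)) (inj₁ (R v))     ≡⟨ exchange-antisymmetric A (inj₁ (R v)) (inj₂ (L x)) ⟩
      - exchange A (inj₁ (R v)) (inj₂ (L x))   ≡⟨ cong -_ (right-to-left (inj₂ x) v) ⟩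
      - combination (m (inj₂ x)) (cVector A₂ v) ≡⟨ cong -_ (combination-cong (m (inj₂ x)) cVector-red) ⟩
      - combination (m (inj₂ x)) (λ y → - (+ A₂ (inj₂ y) (inj₁ v)))
        ≡⟨ cong -_ (combination-neg (m (inj₂ x)) (λ y → + A₂ (inj₂ y) (inj₁ v))) ⟩
      - - combination (m (inj₂ x)) (λ y → + A₂ (inj₂ y) (inj₁ v))
        ≡⟨ ℤP.neg-involutive _ ⟩
      combination (m (inj₂ x)) (λ y → + A₂ (inj₂ y) (inj₁ v)) ≡⟨ combination≡n ⟩
      + n ∎)
      where open ≡-Reasoning

  direct-sum-green : IsQuiver Q₁ → IsQuiver Q₂ → (μ₁ : List (Fin N₁)) (μ₂ : List (Fin N₂)) →
    InGreen Q₁ μ₁ → InGreen Q₂ μ₂ → InGreen D (incl₁ {N₁} {N₂} μ₁ ++ incl₂ {N₁} {N₂} μ₂)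
  direct-sum-green Q₁-quiver Q₂-quiver μ₁ μ₂ (μ₁-green , μ₁-red) (μ₂-green , μ₂-red)
    with left-phase μ₁ (leftPhase-start Q₁-quiver Q₂-quiver) μ₁-green
  ... | lifted-μ₁-green , after-μ₁
    with right-phase μ₂ (rightPhase-start after-μ₁ μ₁-red) μ₂-green
  ... | lifted-μ₂-green , after-μ₂ =
    greenSeq-++ (incl₁ {N₁} {N₂} μ₁) (incl₂ {N₁} {N₂} μ₂) (framed D) lifted-μ₁-green lifted-μ₂-green ,
    subst (λ A → ∀ i → IsRed A i) (sym (mutateSeq-++ (incl₁ {N₁} {N₂} μ₁) (incl₂ {N₁} {N₂} μ₂) (framed D)))
          (all-red after-μ₂ μ₂-red)

-- Proposition 3.8.  The argument does not use that b is injective: it works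
-- for any number of arrows from a to each vertex of Q₂.
proposition3p8 : {N₁ N₂ k : ℕ} (Q₁ : Arrows (Fin N₁)) (Q₂ : Arrows (Fin N₂))
    → IsQuiver Q₁ → IsQuiver Q₂
    → (a : Fin N₁) (b : Fin k → Fin N₂) → Injective _≡_ _≡_ b
    → (μ₁ : List (Fin N₁)) (μ₂ : List (Fin N₂))
    → InGreen Q₁ μ₁ → InGreen Q₂ μ₂
    → InGreen (directSum Q₁ Q₂ (λ _ → a) b) (incl₁ {N₁} {N₂} μ₁ ++ incl₂ {N₁} {N₂} μ₂)
proposition3p8 Q₁ Q₂ Q₁-quiver Q₂-quiver a b _ =
  GreenSequencesOnDirectSum.direct-sum-green Q₁ Q₂ a b Q₁-quiver Q₂-quiver
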